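{- Let $W:\mathbb{Z}\to\mathbb{Z}$ be defined by $W(0)=W(1)=0$, $W(2)=2$, $W(3)=8$ and $W(n+4)=2W(n+3)-W(n)$ for all $n\in\mathbb{Z}$. Then the integers $n$ with $W(n)=0$ are exactly $-51,-12,-5,-3,0,1$. -}

module Defs where

open import Data.Integer using (ℤ; _+_; _-_; _*_; +_; -[1+_])
open import Relation.Binary.PropositionalEquality using (_≡_)
open import Data.Product using (_×_)

IsW : (ℤ → ℤ) → Set
IsW W =
  (W (+ 0) ≡ + 0) × (W (+ 1) ≡ + 0) × (W (+ 2) ≡ + 2) × (W (+ 3) ≡ + 8) ×
  (∀ (n : ℤ) → W (n + + 4) ≡ (+ 2) * W (n + + 3) - W n)

data InZeroSet : ℤ → Set where
  z-51 : InZeroSet -[1+ 50 ]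
  z-12 : InZeroSet -[1+ 11 ]
  z-5  : InZeroSet -[1+ 4 ]
  z-3  : InZeroSet -[1+ 2 ]
  z0   : InZeroSet (+ 0)
  z1   : InZeroSet (+ 1)

{-# OPTIONS --safe #-}
module Submission where

open import Defs
open import Data.Integer using (ℤ; +_)
open import Relation.Binary.PropositionalEquality using (_≡_)
open import Function.Bundles using (_⇔_)

open import Data.Empty using (⊥-elim)
open import Data.Integer.Base
  using (0ℤ; 1ℤ; -[1+_]; _+_; _-_; _*_; -_; _^_; ∣_∣; NonZero; ≢-nonZero; _/ℕ_; _%ℕ_)
open import Data.Integer.DivMod using (a≡a%ℕn+[a/ℕn]*n; n%ℕd<d)
open import Data.Integer.Divisibility.Signed
  using (_∣_; divides; _∣?_; ∣-trans; ∣m∣n⇒∣m+n; ∣m∣n⇒∣m-n; ∣m⇒∣-m; ∣n⇒∣m*n;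
         *-monoʳ-∣; *-monoˡ-∣; *-cancelˡ-∣; ∣⇒∣ᵤ; ∣ᵤ⇒∣)
open import Data.Integer.Properties
  using (_≟_; +-assoc; +-identityʳ; +-inverseʳ; *-assoc; *-comm; *-identityˡ; *-identityʳ;
         pos-+; pos-*; abs-*; neg-distribˡ-*; i*j≢0; ^-identityʳ; ^-distribˡ-+-*)
open import Data.Integer.Tactic.RingSolver using (solve-∀)
open import Data.List using (List; []; _∷_)
open import Data.List.Membership.Propositional using (_∈_; find)
open import Data.List.Relation.Unary.All using (All; all?; lookup)
open import Data.List.Relation.Unary.Any using (Any; here; there; any?)
open import Data.Nat as ℕ using (ℕ; zero; suc)
open import Data.Nat.Divisibility as ℕ using ()
open import Data.Nat.Induction using (<-wellFounded)
open import Data.Nat.Primality using (Prime; prime?; euclidsLemma; prime⇒nonZero; prime⇒nonTrivial)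
import Data.Nat.Properties as ℕ
open import Data.Product using (_×_; _,_; ∃)
open import Data.Sum using (_⊎_; [_,_]′; map)
open import Function using (_∘_)
open import Function.Bundles using (mk⇔)
open import Induction.WellFounded using (Acc; acc)
open import Relation.Binary.PropositionalEquality
  using (_≢_; refl; sym; trans; cong; cong₂; subst; subst₂; module ≡-Reasoning)
open import Relation.Nullary using (¬_; Dec; yes; no)
open import Relation.Nullary.Decidable using (True; toWitness; from-yes; ¬?; _×-dec_; _→-dec_)

-- W satisfies a linear recurrence, so every difference Δ_Q W(n) = W(n + Q) - W(n) is again
-- a recurrence sequence, and W(n + j) is an explicit integer combination of W(n), ..., W(n + 3).
-- For Q = 336 the coefficients of Δ_Q are divisible by 637 = 7² · 13, so W is 336-periodic
-- modulo 637, and checking one period leaves six residue classes, each containing one of the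
-- listed zeros z.  Inside such a class Skolem's 13-adic argument applies: the coefficients
-- also give Δ_{13 Q} ≡ 13 Δ_Q (mod 13³), and by induction Δ_{13^m Q} W ≡ 13^m Δ_Q W
-- (mod 13^(m+2)).  Hence W(z + k 13^m Q) ≡ k 13^m Δ_Q W(z) (mod 13^(m+2)), and since 13
-- exactly divides Δ_Q W(z), descending through the powers of 13 dividing k shows that
-- W(z + k Q) ≠ 0 for k ≠ 0.

1∣ : ∀ x → 1ℤ ∣ x
1∣ x = divides x (sym (*-identityʳ x))

^-nonZero : ∀ i .{{_ : NonZero i}} n → NonZero (i ^ n)
^-nonZero i         zero    = _
^-nonZero i {{i≢0}} (suc n) = i*j≢0 i (i ^ n) {{i≢0}} {{^-nonZero i n}}

∣-weaken-^ : ∀ r i t e {x} → r * i ^ (t ℕ.+ e) ∣ x → r * i ^ e ∣ x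
∣-weaken-^ r i t e = ∣-trans (*-monoʳ-∣ r (divides (i ^ t) (^-distribˡ-+-* i t e)))

∣i∣<∣i*j∣ : ∀ {i} j → i ≢ 0ℤ → 1 ℕ.< ∣ j ∣ → ∣ i ∣ ℕ.< ∣ i * j ∣
∣i∣<∣i*j∣ {i} j i≢0 1<∣j∣ =
  subst (∣ i ∣ ℕ.<_) (sym (abs-* i j)) (ℕ.m<m*n ∣ i ∣ ∣ j ∣ {{≢-nonZero i≢0}} 1<∣j∣)

euclidsLemmaℤ : ∀ a b {p} → Prime p → + p ∣ a * b → (+ p ∣ a) ⊎ (+ p ∣ b)
euclidsLemmaℤ a b p-prime p∣ab =
  map ∣ᵤ⇒∣ ∣ᵤ⇒∣ (euclidsLemma ∣ a ∣ ∣ b ∣ p-prime (subst (_ ℕ.∣_) (abs-* a b) (∣⇒∣ᵤ p∣ab)))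

%ℕ≡%ℕ⇒≡+* : ∀ m n d .{{_ : ℕ.NonZero d}} → m %ℕ d ≡ n %ℕ d → m ≡ n + (m /ℕ d - n /ℕ d) * + d
%ℕ≡%ℕ⇒≡+* m n d m%d≡n%d = begin
  m                                                      ≡⟨ a≡a%ℕn+[a/ℕn]*n m d ⟩
  + (m %ℕ d) + (m /ℕ d) * + d                            ≡⟨ cong (λ r → + r + (m /ℕ d) * + d) m%d≡n%d ⟩
  + (n %ℕ d) + (m /ℕ d) * + d                            ≡⟨ regroup (+ (n %ℕ d)) (m /ℕ d) (n /ℕ d) (+ d) ⟩
  + (n %ℕ d) + (n /ℕ d) * + d + (m /ℕ d - n /ℕ d) * + d  ≡⟨ cong (_+ (m /ℕ d - n /ℕ d) * + d)
                                                                 (sym (a≡a%ℕn+[a/ℕn]*n n d)) ⟩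
  n + (m /ℕ d - n /ℕ d) * + d                            ∎
  where
  open ≡-Reasoning
  regroup : ∀ r a b d → r + a * d ≡ r + b * d + (a - b) * d
  regroup = solve-∀

-- Finite differences

Δ : ℤ → (ℤ → ℤ) → ℤ → ℤ
Δ Q f n = f (n + Q) - f n

Δ-0 : ∀ f n → Δ 0ℤ f n ≡ 0ℤ
Δ-0 f n = trans (cong (λ i → f i - f n) (+-identityʳ n)) (+-inverseʳ (f n))

Δ-+ : ∀ a b f n → Δ (a + b) f n ≡ Δ a f n + Δ b f (n + a)
Δ-+ a b f n = begin
  f (n + (a + b)) - f n    ≡⟨ cong (λ i → f i - f n) (sym (+-assoc n a b)) ⟩
  f (n + a + b) - f n      ≡⟨ telescope (f (n + a + b)) (f (n + a)) (f n) ⟩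
  Δ a f n + Δ b f (n + a)  ∎
  where
  open ≡-Reasoning
  telescope : ∀ x y z → x - z ≡ (y - z) + (x - y)
  telescope = solve-∀

Δ-neg : ∀ a f n → Δ (- a) f n ≡ - Δ a f (n - a)
Δ-neg a f n = begin
  f (n - a) - f n                ≡⟨ cong (λ i → f (n - a) - f i) (sym (sub-add n a)) ⟩
  f (n - a) - f (n - a + a)      ≡⟨ swap (f (n - a)) (f (n - a + a)) ⟩
  - (f (n - a + a) - f (n - a))  ∎
  where
  open ≡-Reasoning
  sub-add : ∀ n a → n - a + a ≡ n
  sub-add = solve-∀
  swap : ∀ x y → x - y ≡ - (y - x)
  swap = solve-∀

∣Δ⇒∣Δ-multiple : ∀ {d Q f} → (∀ n → d ∣ Δ Q f n) → ∀ k n → d ∣ Δ (k * Q) f n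
∣Δ⇒∣Δ-multiple {d} {Q} {f} d∣Δ = multiple
  where
  suc-* : ∀ j → + suc j * Q ≡ + j * Q + Q
  suc-* j = trans (cong (_* Q) (pos-+ 1 j)) (distrib (+ j) Q)
    where
    distrib : ∀ j Q → (+ 1 + j) * Q ≡ j * Q + Q
    distrib = solve-∀
  natural : ∀ j n → d ∣ Δ (+ j * Q) f n
  natural zero    n = subst (d ∣_) (sym (Δ-0 f n)) (divides 0ℤ refl)
  natural (suc j) n =
    subst (d ∣_) (sym (trans (cong (λ a → Δ a f n) (suc-* j)) (Δ-+ (+ j * Q) Q f n)))
      (∣m∣n⇒∣m+n (natural j n) (d∣Δ (n + + j * Q)))
  multiple : ∀ k n → d ∣ Δ (k * Q) f n
  multiple (+ j)    n = natural j n
  multiple -[1+ j ] n = subst (d ∣_) (sym Δ≡) (∣m⇒∣-m (natural (suc j) (n - S)))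
    where
    S : ℤ
    S = + suc j * Q
    Δ≡ : Δ (-[1+ j ] * Q) f n ≡ - Δ S f (n - S)
    Δ≡ = trans (cong (λ a → Δ a f n) (sym (neg-distribˡ-* (+ suc j) Q))) (Δ-neg S f n)

∣Δ²⇒∣Δ-linear : ∀ {d Q f} → (∀ n → d ∣ Δ Q (Δ Q f) n) → ∀ k n → d ∣ Δ (k * Q) f n - k * Δ Q f n
∣Δ²⇒∣Δ-linear {d} {Q} {f} d∣Δ² k n = subst (d ∣_) F-difference (∣Δ⇒∣Δ-multiple {f = F} ∣ΔF k 0ℤ)
  where
  open ≡-Reasoning
  D : ℤ
  D = Δ Q f n
  F : ℤ → ℤ
  F k = f (n + k * Q) - k * D
  ∣ΔF : ∀ k → d ∣ Δ 1ℤ F k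
  ∣ΔF k = subst (d ∣_) ΔF≡ (∣Δ⇒∣Δ-multiple {f = Δ Q f} d∣Δ² k n)
    where
    step : ∀ n k Q → n + k * Q + Q ≡ n + (k + 1ℤ) * Q
    step = solve-∀
    regroup : ∀ x y e k → (x - y) - e ≡ (x - (k + 1ℤ) * e) - (y - k * e)
    regroup = solve-∀
    ΔF≡ : Δ (k * Q) (Δ Q f) n ≡ Δ 1ℤ F k
    ΔF≡ = begin
      (f (n + k * Q + Q) - f (n + k * Q)) - D
        ≡⟨ cong (λ i → (f i - f (n + k * Q)) - D) (step n k Q) ⟩
      (f (n + (k + 1ℤ) * Q) - f (n + k * Q)) - D
        ≡⟨ regroup (f (n + (k + 1ℤ) * Q)) (f (n + k * Q)) D k ⟩
      F (k + 1ℤ) - F k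
        ∎
  F-difference : Δ (k * 1ℤ) F 0ℤ ≡ Δ (k * Q) f n - k * D
  F-difference = begin
    F (0ℤ + k * 1ℤ) - F 0ℤ                  ≡⟨ cong (λ j → F j - F 0ℤ) (unit k) ⟩
    F k - (f (n + 0ℤ) - 0ℤ)                 ≡⟨ cong (λ i → F k - (f i - 0ℤ)) (+-identityʳ n) ⟩
    (f (n + k * Q) - k * D) - (f n - 0ℤ)    ≡⟨ regroup (f (n + k * Q)) (f n) (k * D) ⟩
    Δ (k * Q) f n - k * D                   ∎
    where
    unit : ∀ k → 0ℤ + k * 1ℤ ≡ k
    unit = solve-∀
    regroup : ∀ x y z → (x - z) - (y - 0ℤ) ≡ (x - y) - z
    regroup = solve-∀

-- Skolem's p-adic method

module Skolem (Recurrent : (ℤ → ℤ) → Set)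
              (Δ-recurrent : ∀ {X} Q → Recurrent X → Recurrent (Δ Q X)) where

  Contracts : ℤ → ℤ → Set
  Contracts Q q = ∀ {r X} → Recurrent X → (∀ n → r ∣ X n) → ∀ n → r * q ∣ Δ Q X n

  contracts⇒∣Δ-linear : ∀ {Q q r X} → Contracts Q q → Recurrent X → (∀ n → r ∣ X n) →
                        ∀ k n → r * q * q ∣ Δ (k * Q) X n - k * Δ Q X n
  contracts⇒∣Δ-linear {Q} {X = X} contracts rec r∣X =
    ∣Δ²⇒∣Δ-linear {f = X} (contracts (Δ-recurrent Q rec) (contracts rec r∣X))

  ScalesAt : ℤ → ℤ → ℕ → Set
  ScalesAt P Q m = ∀ {r X} → Recurrent X → (∀ n → r ∣ X n) →
                   ∀ n → r * P ^ suc (suc m) ∣ Δ (P ^ m * Q) X n - P ^ m * Δ Q X n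

  module _ {p} (p-prime : Prime p) {Q} (contracts : Contracts Q (+ p)) (scales₁ : ScalesAt (+ p) Q 1) where

    private
      P : ℤ
      P = + p

    scales⇒contracts : ∀ m → ScalesAt P Q m → Contracts (P ^ m * Q) (P ^ suc m)
    scales⇒contracts m scales {r} {X} rec r∣X n =
      subst (r * P ^ suc m ∣_) (sub-add (Δ (P ^ m * Q) X n) (P ^ m * Δ Q X n))
        (∣m∣n⇒∣m+n (∣-weaken-^ r P 1 (suc m) (scales rec r∣X n))
                   (subst (_∣ P ^ m * Δ Q X n) (reorder r P (P ^ m)) (*-monoʳ-∣ (P ^ m) (contracts rec r∣X n))))
      where
      sub-add : ∀ x y → x - y + y ≡ x
      sub-add = solve-∀
      reorder : ∀ r P x → x * (r * P) ≡ r * (P * x)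
      reorder = solve-∀

    scales-0 : ScalesAt P Q 0
    scales-0 {X = X} rec r∣X n =
      subst (_ ∣_) (sym (trans (cong (λ a → Δ a X n - 1ℤ * Δ Q X n) (*-identityˡ Q)) (cancel (Δ Q X n))))
        (divides 0ℤ refl)
      where
      cancel : ∀ x → x - 1ℤ * x ≡ 0ℤ
      cancel = solve-∀

    scales-suc : ∀ m → ScalesAt P Q (suc m) → ScalesAt P Q (suc (suc m))
    scales-suc m scales {r} {X} rec r∣X n =
      subst₂ _∣_ (square (P ^ m) r P) combine
        (∣m∣n⇒∣m+n (∣-trans (divides (P ^ m) (drop (P ^ m) r P)) linear)
                   (*-monoʳ-∣ P (scales rec r∣X n)))
      where
      S : ℤ
      S = P ^ suc m * Q
      linear : r * P ^ suc (suc m) * P ^ suc (suc m) ∣ Δ (P * S) X n - P * Δ S X n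
      linear = contracts⇒∣Δ-linear (scales⇒contracts (suc m) scales) rec r∣X P n
      drop : ∀ x r P → r * (P * (P * x)) * (P * (P * x)) ≡ x * (P * (r * (P * (P * (P * x)))))
      drop = solve-∀
      square : ∀ x r P → P * (r * (P * (P * (P * x)))) ≡ r * (P * (P * (P * (P * x))))
      square = solve-∀
      regroup : ∀ a b c P x → a - P * b + P * (b - x * c) ≡ a - (P * x) * c
      regroup = solve-∀
      combine : Δ (P * S) X n - P * Δ S X n + P * (Δ S X n - P ^ suc m * Δ Q X n)
              ≡ Δ (P ^ suc (suc m) * Q) X n - P ^ suc (suc m) * Δ Q X n
      combine = trans (regroup (Δ (P * S) X n) (Δ S X n) (Δ Q X n) P (P ^ suc m))
                      (cong (λ a → Δ a X n - P ^ suc (suc m) * Δ Q X n) (sym (*-assoc P (P ^ suc m) Q)))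

    scales : ∀ m → ScalesAt P Q m
    scales zero          = scales-0
    scales (suc zero)    = scales₁
    scales (suc (suc m)) = scales-suc m (scales (suc m))

    P∣k*c : ∀ {X z c} m k → Recurrent X → X z ≡ 0ℤ → Δ Q X z ≡ c * P →
            X (z + k * (P ^ m * Q)) ≡ 0ℤ → P ∣ k * c
    P∣k*c {X} {z} {c} m k rec Xz≡0 ΔQ≡cP Xk≡0 =
      *-cancelˡ-∣ (P ^ suc m) {{^-nonZero P {{prime⇒nonZero p-prime}} (suc m)}}
        (subst₂ _∣_ (shape P (P ^ m)) value
          (∣m∣n⇒∣m-n (∣m⇒∣-m (∣-trans (divides (P ^ m) (drop (P ^ m) P)) linear))
                     (∣n⇒∣m*n k (scales m rec (1∣ ∘ X) z))))
      where
      open ≡-Reasoning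
      E : ℤ
      E = Δ (P ^ m * Q) X z
      linear : 1ℤ * P ^ suc m * P ^ suc m ∣ Δ (k * (P ^ m * Q)) X z - k * E
      linear = contracts⇒∣Δ-linear (scales⇒contracts m (scales m)) rec (1∣ ∘ X) k z
      drop : ∀ x P → 1ℤ * (P * x) * (P * x) ≡ x * (1ℤ * (P * (P * x)))
      drop = solve-∀
      shape : ∀ P x → 1ℤ * (P * (P * x)) ≡ (P * x) * P
      shape = solve-∀
      regroup : ∀ E k c x P → - ((0ℤ - 0ℤ) - k * E) - k * (E - x * (c * P)) ≡ (P * x) * (k * c)
      regroup = solve-∀
      value : - (Δ (k * (P ^ m * Q)) X z - k * E) - k * (E - P ^ m * Δ Q X z) ≡ P ^ suc m * (k * c)
      value = begin
        - ((X (z + k * (P ^ m * Q)) - X z) - k * E) - k * (E - P ^ m * Δ Q X z)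
          ≡⟨ cong₂ (λ a b → - ((a - b) - k * E) - k * (E - P ^ m * Δ Q X z)) Xk≡0 Xz≡0 ⟩
        - ((0ℤ - 0ℤ) - k * E) - k * (E - P ^ m * Δ Q X z)
          ≡⟨ cong (λ d → - ((0ℤ - 0ℤ) - k * E) - k * (E - P ^ m * d)) ΔQ≡cP ⟩
        - ((0ℤ - 0ℤ) - k * E) - k * (E - P ^ m * (c * P))
          ≡⟨ regroup E k c (P ^ m) P ⟩
        P ^ suc m * (k * c)
          ∎

    isolated-zero : ∀ {X z} → Recurrent X → X z ≡ 0ℤ → ¬ (P * P ∣ Δ Q X z) →
                    ∀ k → X (z + k * Q) ≡ 0ℤ → k ≡ 0ℤ
    isolated-zero {X} {z} rec Xz≡0 P²∤ΔQ k Xk≡0 with contracts rec (1∣ ∘ X) z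
    ... | divides c ΔQ≡c*[1*P] =
      descend 0 k (<-wellFounded ∣ k ∣) (subst (λ a → X (z + k * a) ≡ 0ℤ) (sym (*-identityˡ Q)) Xk≡0)
      where
      ΔQ≡cP : Δ Q X z ≡ c * P
      ΔQ≡cP = trans ΔQ≡c*[1*P] (cong (c *_) (*-identityˡ P))
      P∤c : ¬ P ∣ c
      P∤c P∣c = P²∤ΔQ (subst (P * P ∣_) (sym ΔQ≡cP) (*-monoˡ-∣ P P∣c))
      1<p : 1 ℕ.< ∣ P ∣
      1<p = ℕ.nonTrivial⇒n>1 p {{prime⇒nonTrivial p-prime}}
      reassoc : ∀ k P x Q → k * P * (x * Q) ≡ k * (P * x * Q)
      reassoc = solve-∀
      descend : ∀ m k → Acc ℕ._<_ ∣ k ∣ → X (z + k * (P ^ m * Q)) ≡ 0ℤ → k ≡ 0ℤ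
      descend m k (acc smaller) Xk≡0 with k ≟ 0ℤ
      ... | yes k≡0 = k≡0
      ... | no k≢0  = [ P∣k⇒k≡0 , ⊥-elim ∘ P∤c ]′ (euclidsLemmaℤ k c p-prime (P∣k*c m k rec Xz≡0 ΔQ≡cP Xk≡0))
        where
        P∣k⇒k≡0 : P ∣ k → k ≡ 0ℤ
        P∣k⇒k≡0 (divides k′ k≡k′P) = trans k≡k′P (cong (_* P) k′≡0)
          where
          k′≢0 : k′ ≢ 0ℤ
          k′≢0 k′≡0 = k≢0 (trans k≡k′P (cong (_* P) k′≡0))
          ∣k′∣<∣k∣ : ∣ k′ ∣ ℕ.< ∣ k ∣
          ∣k′∣<∣k∣ = subst (λ i → ∣ k′ ∣ ℕ.< ∣ i ∣) (sym k≡k′P) (∣i∣<∣i*j∣ P k′≢0 1<p)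
          Xk′≡0 : X (z + k′ * (P ^ suc m * Q)) ≡ 0ℤ
          Xk′≡0 = subst (λ a → X (z + a) ≡ 0ℤ)
                    (trans (cong (_* (P ^ m * Q)) k≡k′P) (reassoc k′ P (P ^ m) Q)) Xk≡0
          k′≡0 : k′ ≡ 0ℤ
          k′≡0 = descend (suc m) k′ (smaller ∣k′∣<∣k∣) Xk′≡0

Recurrent : (ℤ → ℤ) → Set
Recurrent X = ∀ n → X (n + + 4) ≡ + 2 * X (n + + 3) - X n

Δ-recurrent : ∀ {X} Q → Recurrent X → Recurrent (Δ Q X)
Δ-recurrent {X} Q rec n = begin
  X (n + + 4 + Q) - X (n + + 4)
    ≡⟨ cong (λ i → X i - X (n + + 4)) (swap n (+ 4) Q) ⟩
  X (n + Q + + 4) - X (n + + 4)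
    ≡⟨ cong₂ _-_ (rec (n + Q)) (rec n) ⟩
  (+ 2 * X (n + Q + + 3) - X (n + Q)) - (+ 2 * X (n + + 3) - X n)
    ≡⟨ cong (λ i → (+ 2 * X i - X (n + Q)) - (+ 2 * X (n + + 3) - X n)) (swap n Q (+ 3)) ⟩
  (+ 2 * X (n + + 3 + Q) - X (n + Q)) - (+ 2 * X (n + + 3) - X n)
    ≡⟨ regroup (X (n + + 3 + Q)) (X (n + Q)) (X (n + + 3)) (X n) ⟩
  + 2 * Δ Q X (n + + 3) - Δ Q X n
    ∎
  where
  open ≡-Reasoning
  swap : ∀ n a b → n + a + b ≡ n + b + a
  swap = solve-∀
  regroup : ∀ a b c d → (+ 2 * a - b) - (+ 2 * c - d) ≡ + 2 * (a - c) - (b - d)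
  regroup = solve-∀

open Skolem Recurrent (λ {X} → Δ-recurrent {X})

record Window : Set where
  constructor ⟨_,_,_,_⟩
  field
    w₀ w₁ w₂ w₃ : ℤ

⟨⟩-cong : ∀ {a b c d a′ b′ c′ d′} → a ≡ a′ → b ≡ b′ → c ≡ c′ → d ≡ d′ →
          ⟨ a , b , c , d ⟩ ≡ ⟨ a′ , b′ , c′ , d′ ⟩
⟨⟩-cong refl refl refl refl = refl

window : (ℤ → ℤ) → ℤ → Window
window X n = ⟨ X n , X (n + + 1) , X (n + + 2) , X (n + + 3) ⟩

infix 7 _·_
_·_ : Window → Window → ℤ
⟨ a , b , c , d ⟩ · ⟨ x , y , z , t ⟩ = a * x + b * y + c * z + d * t

e₀ : Window
e₀ = ⟨ 1ℤ , 0ℤ , 0ℤ , 0ℤ ⟩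

e₀-· : ∀ X n → X n ≡ e₀ · window X n
e₀-· X n = unit (X n) (X (n + + 1)) (X (n + + 2)) (X (n + + 3))
  where
  unit : ∀ x y z t → x ≡ 1ℤ * x + 0ℤ * y + 0ℤ * z + 0ℤ * t
  unit = solve-∀

next prev nextᵀ prevᵀ : Window → Window
next  ⟨ a , b , c , d ⟩ = ⟨ b , c , d , + 2 * d - a ⟩
prev  ⟨ a , b , c , d ⟩ = ⟨ + 2 * c - d , a , b , c ⟩
nextᵀ ⟨ a , b , c , d ⟩ = ⟨ - d , a , b , c + + 2 * d ⟩
prevᵀ ⟨ a , b , c , d ⟩ = ⟨ b , c , d + + 2 * a , - a ⟩

nextᵀ-· : ∀ u v → nextᵀ u · v ≡ u · next v
nextᵀ-· ⟨ a , b , c , d ⟩ ⟨ x , y , z , t ⟩ = adjoint a b c d x y z t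
  where
  adjoint : ∀ a b c d x y z t →
            - d * x + a * y + b * z + (c + + 2 * d) * t ≡ a * y + b * z + c * t + d * (+ 2 * t - x)
  adjoint = solve-∀

prevᵀ-· : ∀ u v → prevᵀ u · v ≡ u · prev v
prevᵀ-· ⟨ a , b , c , d ⟩ ⟨ x , y , z , t ⟩ = adjoint a b c d x y z t
  where
  adjoint : ∀ a b c d x y z t →
            b * x + c * y + (d + + 2 * a) * z + - a * t ≡ a * (+ 2 * z - t) + b * x + c * y + d * z
  adjoint = solve-∀

window-next : ∀ {X} → Recurrent X → ∀ n → window X (n + + 1) ≡ next (window X n)
window-next {X} rec n = ⟨⟩-cong refl (shift 1) (shift 2) (trans (shift 3) (rec n))
  where
  shift : ∀ j → X (n + + 1 + + j) ≡ X (n + + suc j)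
  shift j = cong X (+-assoc n (+ 1) (+ j))

window-prev : ∀ {X} → Recurrent X → ∀ n → window X (n - + 1) ≡ prev (window X n)
window-prev {X} rec n = ⟨⟩-cong X[n-1] (trans (shift 0) (cong X (+-identityʳ n))) (shift 1) (shift 2)
  where
  shift : ∀ j → X (n - + 1 + + suc j) ≡ X (n + + j)
  shift j = cong X (+-assoc n -[1+ 0 ] (+ suc j))
  solve-for : ∀ x y → x ≡ + 2 * y - (+ 2 * y - x)
  solve-for = solve-∀
  X[n-1] : X (n - + 1) ≡ + 2 * X (n + + 2) - X (n + + 3)
  X[n-1] = begin
    X (n - + 1)
      ≡⟨ solve-for (X (n - + 1)) (X (n - + 1 + + 3)) ⟩
    + 2 * X (n - + 1 + + 3) - (+ 2 * X (n - + 1 + + 3) - X (n - + 1))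
      ≡⟨ cong (λ a → + 2 * X (n - + 1 + + 3) - a) (sym (rec (n - + 1))) ⟩
    + 2 * X (n - + 1 + + 3) - X (n - + 1 + + 4)
      ≡⟨ cong₂ (λ a b → + 2 * a - b) (shift 2) (shift 3) ⟩
    + 2 * X (n + + 2) - X (n + + 3)
      ∎
    where open ≡-Reasoning

forward backward : ℕ → Window
forward zero     = e₀
forward (suc j)  = nextᵀ (forward j)
backward zero    = e₀
backward (suc j) = prevᵀ (backward j)

ahead : ∀ {X} → Recurrent X → ∀ j n → X (n + + j) ≡ forward j · window X n
ahead {X} rec zero    n = trans (cong X (+-identityʳ n)) (e₀-· X n)
ahead {X} rec (suc j) n = begin
  X (n + + suc j)                 ≡⟨ cong X (sym (+-assoc n (+ 1) (+ j))) ⟩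
  X (n + + 1 + + j)               ≡⟨ ahead {X} rec j (n + + 1) ⟩
  forward j · window X (n + + 1)  ≡⟨ cong (forward j ·_) (window-next {X} rec n) ⟩
  forward j · next (window X n)   ≡⟨ sym (nextᵀ-· (forward j) (window X n)) ⟩
  forward (suc j) · window X n    ∎
  where open ≡-Reasoning

behind : ∀ {X} → Recurrent X → ∀ j n → X (n - + j) ≡ backward j · window X n
behind {X} rec zero    n = trans (cong X (+-identityʳ n)) (e₀-· X n)
behind {X} rec (suc j) n = begin
  X (n - + suc j)                  ≡⟨ cong X (split n (+ j)) ⟩
  X (n - + 1 - + j)                ≡⟨ behind {X} rec j (n - + 1) ⟩
  backward j · window X (n - + 1)  ≡⟨ cong (backward j ·_) (window-prev {X} rec n) ⟩
  backward j · prev (window X n)   ≡⟨ sym (prevᵀ-· (backward j) (window X n)) ⟩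
  backward (suc j) · window X n    ∎
  where
  open ≡-Reasoning
  split : ∀ n j → n - (+ 1 + j) ≡ n - + 1 - j
  split = solve-∀

initial : Window
initial = ⟨ 0ℤ , 0ℤ , + 2 , + 8 ⟩

w : ℤ → ℤ
w (+ j)    = forward j · initial
w -[1+ j ] = backward (suc j) · initial

IsW⇒≗w : ∀ W → IsW W → ∀ n → W n ≡ w n
IsW⇒≗w W (W0 , W1 , W2 , W3 , rec) (+ j) =
  trans (ahead {W} rec j 0ℤ) (cong (forward j ·_) (⟨⟩-cong W0 W1 W2 W3))
IsW⇒≗w W (W0 , W1 , W2 , W3 , rec) -[1+ j ] =
  trans (behind {W} rec (suc j) 0ℤ) (cong (backward (suc j) ·_) (⟨⟩-cong W0 W1 W2 W3))

infixl 6 _-ᵂ_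
infixr 7 _*ᵂ_
_-ᵂ_ : Window → Window → Window
⟨ a , b , c , d ⟩ -ᵂ ⟨ x , y , z , t ⟩ = ⟨ a - x , b - y , c - z , d - t ⟩

_*ᵂ_ : ℤ → Window → Window
k *ᵂ ⟨ a , b , c , d ⟩ = ⟨ k * a , k * b , k * c , k * d ⟩

·-distribʳ-ᵂ : ∀ u v x → (u -ᵂ v) · x ≡ u · x - v · x
·-distribʳ-ᵂ ⟨ a , b , c , d ⟩ ⟨ a′ , b′ , c′ , d′ ⟩ ⟨ x , y , z , t ⟩ = distrib a b c d a′ b′ c′ d′ x y z t
  where
  distrib : ∀ a b c d a′ b′ c′ d′ x y z t →
            (a - a′) * x + (b - b′) * y + (c - c′) * z + (d - d′) * t ≡
            (a * x + b * y + c * z + d * t) - (a′ * x + b′ * y + c′ * z + d′ * t)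
  distrib = solve-∀

·-*ᵂ : ∀ k u x → (k *ᵂ u) · x ≡ k * (u · x)
·-*ᵂ k ⟨ a , b , c , d ⟩ ⟨ x , y , z , t ⟩ = distrib k a b c d x y z t
  where
  distrib : ∀ k a b c d x y z t →
            k * a * x + k * b * y + k * c * z + k * d * t ≡ k * (a * x + b * y + c * z + d * t)
  distrib = solve-∀

Δ-window : ∀ {X} → Recurrent X → ∀ j n → Δ (+ j) X n ≡ (forward j -ᵂ e₀) · window X n
Δ-window {X} rec j n =
  trans (cong₂ _-_ (ahead {X} rec j n) (e₀-· X n)) (sym (·-distribʳ-ᵂ (forward j) e₀ (window X n)))

infix 4 _∣ᵂ_ _∣ᵂ?_
_∣ᵂ_ : ℤ → Window → Set
q ∣ᵂ ⟨ a , b , c , d ⟩ = (q ∣ a) × (q ∣ b) × (q ∣ c) × (q ∣ d)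

_∣ᵂ?_ : ∀ q u → Dec (q ∣ᵂ u)
q ∣ᵂ? ⟨ a , b , c , d ⟩ = (q ∣? a) ×-dec (q ∣? b) ×-dec (q ∣? c) ×-dec (q ∣? d)

∣ᵂ-· : ∀ {q r} u v → q ∣ᵂ u → r ∣ᵂ v → r * q ∣ u · v
∣ᵂ-· {q} {r} ⟨ a , b , c , d ⟩ ⟨ x , y , z , t ⟩ (q∣a , q∣b , q∣c , q∣d) (r∣x , r∣y , r∣z , r∣t) =
  ∣m∣n⇒∣m+n (∣m∣n⇒∣m+n (∣m∣n⇒∣m+n (∣* q∣a r∣x) (∣* q∣b r∣y)) (∣* q∣c r∣z)) (∣* q∣d r∣t)
  where
  ∣* : ∀ {a x} → q ∣ a → r ∣ x → r * q ∣ a * x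
  ∣* {a} {x} q∣a r∣x = ∣-trans (subst (_∣ a * r) (*-comm q r) (*-monoˡ-∣ r q∣a)) (*-monoʳ-∣ a r∣x)

window-∣ : ∀ {r X} → (∀ n → r ∣ X n) → ∀ n → r ∣ᵂ window X n
window-∣ r∣X n = r∣X n , r∣X (n + + 1) , r∣X (n + + 2) , r∣X (n + + 3)

coefficients⇒contracts : ∀ {q} j → {True (q ∣ᵂ? forward j -ᵂ e₀)} → Contracts (+ j) q
coefficients⇒contracts {q} j {q∣coefficients} {r} {X} rec r∣X n =
  subst (r * q ∣_) (sym (Δ-window {X} rec j n))
    (∣ᵂ-· _ (window X n) (toWitness q∣coefficients) (window-∣ r∣X n))

coefficients⇒scales : ∀ p j → let P = + p in
                      {True (P ^ 3 ∣ᵂ? forward (p ℕ.* j) -ᵂ e₀ -ᵂ P *ᵂ (forward j -ᵂ e₀))} → ScalesAt P (+ j) 1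
coefficients⇒scales p j {P³∣coefficients} {r} {X} rec r∣X n =
  subst (r * P ^ 3 ∣_) (sym combination) (∣ᵂ-· _ (window X n) (toWitness P³∣coefficients) (window-∣ r∣X n))
  where
  open ≡-Reasoning
  P : ℤ
  P = + p
  u v : Window
  u = forward (p ℕ.* j) -ᵂ e₀
  v = forward j -ᵂ e₀
  combination : Δ (P ^ 1 * + j) X n - P ^ 1 * Δ (+ j) X n ≡ (u -ᵂ P *ᵂ v) · window X n
  combination = begin
    Δ (P ^ 1 * + j) X n - P ^ 1 * Δ (+ j) X n
      ≡⟨ cong₂ (λ a b → Δ (a * + j) X n - b * Δ (+ j) X n) (^-identityʳ P) (^-identityʳ P) ⟩
    Δ (P * + j) X n - P * Δ (+ j) X n
      ≡⟨ cong (λ a → Δ a X n - P * Δ (+ j) X n) (sym (pos-* p j)) ⟩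
    Δ (+ (p ℕ.* j)) X n - P * Δ (+ j) X n
      ≡⟨ cong₂ (λ a b → a - P * b) (Δ-window {X} rec (p ℕ.* j) n) (Δ-window {X} rec j n) ⟩
    u · window X n - P * (v · window X n)
      ≡⟨ cong (λ b → u · window X n - b) (sym (·-*ᵂ P v (window X n))) ⟩
    u · window X n - (P *ᵂ v) · window X n
      ≡⟨ sym (·-distribʳ-ᵂ u (P *ᵂ v) (window X n)) ⟩
    (u -ᵂ P *ᵂ v) · window X n
      ∎

-- The zeros of W

13-prime : Prime 13
13-prime = from-yes (prime? 13)

Δ336-contracts₆₃₇ : Contracts (+ 336) (+ 637)
Δ336-contracts₆₃₇ = coefficients⇒contracts 336

Δ336-contracts₁₃ : Contracts (+ 336) (+ 13)
Δ336-contracts₁₃ = coefficients⇒contracts 336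

Δ336-scales₁₃ : ScalesAt (+ 13) (+ 336) 1
Δ336-scales₁₃ = coefficients⇒scales 13 336

zeros : List ℤ
zeros = -[1+ 50 ] ∷ -[1+ 11 ] ∷ -[1+ 4 ] ∷ -[1+ 2 ] ∷ 0ℤ ∷ 1ℤ ∷ []

∈zeros⇒InZeroSet : ∀ {z} → z ∈ zeros → InZeroSet z
∈zeros⇒InZeroSet (here refl)                                         = z-51
∈zeros⇒InZeroSet (there (here refl))                                 = z-12
∈zeros⇒InZeroSet (there (there (here refl)))                         = z-5
∈zeros⇒InZeroSet (there (there (there (here refl))))                 = z-3
∈zeros⇒InZeroSet (there (there (there (there (here refl)))))         = z0
∈zeros⇒InZeroSet (there (there (there (there (there (here refl)))))) = z1

w-vanishes : ∀ {z} → InZeroSet z → w z ≡ 0ℤ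
w-vanishes z-51 = refl
w-vanishes z-12 = refl
w-vanishes z-5  = refl
w-vanishes z-3  = refl
w-vanishes z0   = refl
w-vanishes z1   = refl

residue-of-zero : ∀ {r} → r ℕ.< 336 → + 637 ∣ w (+ r) → Any (λ z → z %ℕ 336 ≡ r) zeros
residue-of-zero =
  from-yes (ℕ.allUpTo? (λ r → (+ 637 ∣? w (+ r)) →-dec any? (λ z → z %ℕ 336 ℕ.≟ r) zeros) 336)

13²∤Δ336w-at-zeros : All (λ z → ¬ (+ 13 * + 13 ∣ Δ (+ 336) w z)) zeros
13²∤Δ336w-at-zeros = from-yes (all? (λ z → ¬? (+ 13 * + 13 ∣? Δ (+ 336) w z)) zeros)

637∣w[n%336] : ∀ W → IsW W → ∀ {n} → W n ≡ 0ℤ → + 637 ∣ w (+ (n %ℕ 336))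
637∣w[n%336] W isW@(_ , _ , _ , _ , rec) {n} Wn≡0 =
  subst (+ 637 ∣_) (trans W[r]≡ (IsW⇒≗w W isW (+ r))) (∣m⇒∣-m 637∣Δ)
  where
  r : ℕ
  r = n %ℕ 336
  q : ℤ
  q = n /ℕ 336
  637∣Δ : 1ℤ * + 637 ∣ W (+ r + q * + 336) - W (+ r)
  637∣Δ = ∣Δ⇒∣Δ-multiple {f = W} (Δ336-contracts₆₃₇ {X = W} rec (1∣ ∘ W)) q (+ r)
  negate : ∀ x → - (0ℤ - x) ≡ x
  negate = solve-∀
  W[r]≡ : - (W (+ r + q * + 336) - W (+ r)) ≡ W (+ r)
  W[r]≡ = trans (cong (λ a → - (W a - W (+ r))) (sym (a≡a%ℕn+[a/ℕn]*n n 336)))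
                (trans (cong (λ a → - (a - W (+ r))) Wn≡0) (negate (W (+ r))))

zero-unique-mod-336 : ∀ W → IsW W → ∀ {z} → z ∈ zeros → ∀ {n} → n %ℕ 336 ≡ z %ℕ 336 → W n ≡ 0ℤ → n ≡ z
zero-unique-mod-336 W isW@(_ , _ , _ , _ , rec) {z} z∈zeros {n} n%≡z% Wn≡0 = begin
  n              ≡⟨ n≡z+k*336 ⟩
  z + k * + 336  ≡⟨ cong (λ k → z + k * + 336) k≡0 ⟩
  z + 0ℤ         ≡⟨ +-identityʳ z ⟩
  z              ∎
  where
  open ≡-Reasoning
  k : ℤ
  k = n /ℕ 336 - z /ℕ 336
  n≡z+k*336 : n ≡ z + k * + 336
  n≡z+k*336 = %ℕ≡%ℕ⇒≡+* n z 336 n%≡z%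
  Wz≡0 : W z ≡ 0ℤ
  Wz≡0 = trans (IsW⇒≗w W isW z) (w-vanishes (∈zeros⇒InZeroSet z∈zeros))
  Δw≡ΔW : Δ (+ 336) w z ≡ Δ (+ 336) W z
  Δw≡ΔW = sym (cong₂ _-_ (IsW⇒≗w W isW (z + + 336)) (IsW⇒≗w W isW z))
  k≡0 : k ≡ 0ℤ
  k≡0 = isolated-zero 13-prime Δ336-contracts₁₃ Δ336-scales₁₃ {X = W} rec Wz≡0
          (subst (λ d → ¬ (+ 13 * + 13 ∣ d)) Δw≡ΔW (lookup 13²∤Δ336w-at-zeros z∈zeros))
          k (trans (cong W (sym n≡z+k*336)) Wn≡0)

proposition5p6 : (W : ℤ → ℤ) → IsW W → ∀ (n : ℤ) → (W n ≡ + 0) ⇔ InZeroSet n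
proposition5p6 W isW n = mk⇔ zero⇒InZeroSet (λ n∈ → trans (IsW⇒≗w W isW n) (w-vanishes n∈))
  where
  zero⇒InZeroSet : W n ≡ + 0 → InZeroSet n
  zero⇒InZeroSet Wn≡0 = near-zero (find (residue-of-zero (n%ℕd<d n 336) (637∣w[n%336] W isW Wn≡0)))
    where
    -- A separate function rather than `with` or projections: abstracting over the term
    -- `find (residue-of-zero …)` makes Agda unfold the exhaustive check behind it.
    near-zero : ∃ (λ z → z ∈ zeros × z %ℕ 336 ≡ n %ℕ 336) → InZeroSet n
    near-zero (z , z∈zeros , z%≡n%) =
      subst InZeroSet (sym (zero-unique-mod-336 W isW z∈zeros (sym z%≡n%) Wn≡0)) (∈zeros⇒InZeroSet z∈zeros)
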